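{- The Nielsen–Schreier theorem is false in the internal logic of the topos of nominal sets.
   Context: Fix a countably infinite set $\mathbb{A}$ and let $\mathrm{Perm}(\mathbb{A})$ be the group of finitely supported permutations of $\mathbb{A}$ (bijections fixing all but finitely many elements). For a $\mathrm{Perm}(\mathbb{A})$-set $X$, a subset $S\subseteq\mathbb{A}$ supports $x\in X$ if $\pi\cdot x = x$ for every $\pi$ fixing every element of $S$. The topos of nominal sets is the full subcategory of $\mathrm{Perm}(\mathbb{A})$-sets in which every element has a finite support. The Nielsen–Schreier theorem is the statement: for every set $A$ and every subgroup $H$ of the free group $F_A$ on $A$, there exists a subset of $H$ that freely generates $H$. -}

module Defs where

open import Data.Nat using (ℕ)
open import Data.Bool using (Bool; true; false; not; if_then_else_)
open import Data.List using (List; []; _∷_; _++_; map; reverse; concatMap)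
open import Data.List.Membership.Propositional using (_∈_)
open import Data.List.Membership.Propositional.Properties using (∈-++⁺ˡ; ∈-++⁺ʳ)
open import Data.Product using (Σ; Σ-syntax; _×_; _,_; ∃; proj₁; proj₂)
open import Relation.Binary.PropositionalEquality using (_≡_; refl; cong; trans)
open import Relation.Nullary using (¬_)
open import Relation.Unary using (Pred)
open import Level using (0ℓ)

Atom : Set
Atom = ℕ

record Perm : Set where
  field
    to            : Atom → Atom
    from          : Atom → Atom
    to-from       : ∀ a → to (from a) ≡ a
    from-to       : ∀ a → from (to a) ≡ a
    supp          : List Atom
    fixes-outside : ∀ a → ¬ (a ∈ supp) → to a ≡ a

open Perm public

idPerm : Perm
idPerm = record
  { to = λ a → a ; from = λ a → a
  ; to-from = λ _ → refl ; from-to = λ _ → refl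
  ; supp = [] ; fixes-outside = λ _ _ → refl }

_∘P_ : Perm → Perm → Perm
π ∘P σ = record
  { to = λ a → to π (to σ a)
  ; from = λ a → from σ (from π a)
  ; to-from = λ a → trans (cong (to π) (to-from σ (from π a))) (to-from π a)
  ; from-to = λ a → trans (cong (from σ) (from-to π (to σ a))) (from-to σ a)
  ; supp = supp π ++ supp σ
  ; fixes-outside = λ a a∉ →
      trans (cong (to π) (fixes-outside σ a (λ a∈ → a∉ (∈-++⁺ʳ (supp π) a∈))))
            (fixes-outside π a (λ a∈ → a∉ (∈-++⁺ˡ a∈)))
  }

Fixes : Perm → List Atom → Set
Fixes π S = ∀ a → a ∈ S → to π a ≡ a

record NominalSet : Set₁ where
  field
    Carrier : Set
    act     : Perm → Carrier → Carrier
    act-id  : ∀ x → act idPerm x ≡ x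
    act-∘   : ∀ π σ x → act (π ∘P σ) x ≡ act π (act σ x)
    -- the action depends only on the underlying bijection
    act-ext : ∀ π σ → (∀ a → to π a ≡ to σ a) → ∀ x → act π x ≡ act σ x
    finSupp : ∀ x → Σ[ S ∈ List Atom ] (∀ π → Fixes π S → act π x ≡ x)

-- Free groups: words over letters (true = generator, false = its inverse),
-- modulo the free-group congruence over a given relation on generators.

Letter : Set → Set
Letter X = Bool × X

Word : Set → Set
Word X = List (Letter X)

invLetter : {X : Set} → Letter X → Letter X
invLetter (b , x) = (not b , x)

invW : {X : Set} → Word X → Word X
invW w = reverse (map invLetter w)

-- The congruence defining the free group on the setoid (X, R)
-- (R is an equivalence on generators; for plain sets R = _≡_).
data FGEq {X : Set} (R : X → X → Set) : Word X → Word X → Set where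
  fg-refl   : ∀ {u} → FGEq R u u
  fg-sym    : ∀ {u v} → FGEq R u v → FGEq R v u
  fg-trans  : ∀ {u v w} → FGEq R u v → FGEq R v w → FGEq R u w
  fg-gen    : ∀ {b x y} → R x y → FGEq R ((b , x) ∷ []) ((b , y) ∷ [])
  fg-cong   : ∀ {u u′ v v′} → FGEq R u u′ → FGEq R v v′ → FGEq R (u ++ v) (u′ ++ v′)
  fg-cancel : ∀ b x → FGEq R ((b , x) ∷ (not b , x) ∷ []) []

module _ (A : NominalSet) where
  open NominalSet A

  -- elements of F_A are represented by words, equality is _≈F_
  FA : Set
  FA = Word Carrier

  _≈F_ : FA → FA → Set
  _≈F_ = FGEq _≡_

  actF : Perm → FA → FA
  actF π = map (λ l → (proj₁ l , act π (proj₂ l)))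

  -- a subset of (the group) F_A: a predicate on words invariant under ≈F
  RespectsF : Pred FA 0ℓ → Set
  RespectsF P = ∀ {u v} → u ≈F v → P u → P v

  IsSubgroup : Pred FA 0ℓ → Set
  IsSubgroup H = RespectsF H
               × H []
               × (∀ u v → H u → H v → H (u ++ v))
               × (∀ u → H u → H (invW u))

  -- a subset is finitely supported (as an element of the power object)
  FinSuppSubset : Pred FA 0ℓ → Set
  FinSuppSubset P =
    Σ[ S ∈ List Atom ] (∀ π → Fixes π S → ∀ w → P w → P (actF π w))

  evalB : (B : Pred FA 0ℓ) → Word (Σ FA B) → FA
  evalB B = concatMap (λ l → if proj₁ l then proj₁ (proj₂ l) else invW (proj₁ (proj₂ l)))

  FreelyGenerates : (B H : Pred FA 0ℓ) → Set
  FreelyGenerates B H =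
      (∀ w → B w → H w)
    × (∀ w → H w → Σ[ u ∈ Word (Σ FA B) ] (evalB B u ≈F w))
    × (∀ u v → evalB B u ≈F evalB B v
             → FGEq (λ g h → proj₁ g ≈F proj₁ h) u v)

NielsenSchreierNominal : Set₁
NielsenSchreierNominal =
  (A : NominalSet) (H : Pred (FA A) 0ℓ) →
  IsSubgroup A H → FinSuppSubset A H →
  Σ[ B ∈ Pred (FA A) 0ℓ ]
    (RespectsF A B × FinSuppSubset A B × FreelyGenerates A B H)

{-# OPTIONS --safe #-}
module Submission where

-- Let Balanced be the kernel of the abelianisation F_𝔸 → ⊕_𝔸 ℤ; it is an equivariant
-- subgroup. If B is a free basis of it with support S, then for atoms a ≠ b outside S
-- the transposition τ = (a b) permutes B. Sending a, b to the two generators of the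
-- Heisenberg group (and every other atom to 1) maps Balanced into the centre ℤ, giving
-- a homomorphism I = centralPart with I (τ w) = - I w, I [a, b] = 1 and
-- τ [a, b] = [a, b]⁻¹. Write [a, b] = evalB u and let P = positiveWeight : F_B → ℤ send
-- β to the positive part of I β, so that I β = P β - P (τ β). Then
-- P u - P (τ u) = I [a, b] = 1, while evalB (τ u · u) = [a, b]⁻¹ [a, b] = 1 and
-- injectivity of evalB give P (τ u) + P u = 0; hence 2 P u = 1.

open import Defs
open import Relation.Nullary using (¬_)

open import Algebra.Bundles using (Group; AbelianGroup)
open import Algebra.Core using (Op₁; Op₂)
open import Algebra.Definitions using (Commutative)
open import Algebra.Structures using (IsGroup)
open import Data.Bool using (true; false; not)
open import Data.Integer using (ℤ; +_; -[1+_]; +[1+_]; 0ℤ; 1ℤ; _+_; _*_; -_; _-_)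
import Data.Integer.Properties as ℤP
open import Data.Integer.Tactic.RingSolver using (solve)
open import Data.List using ([]; _∷_; _++_; map; reverse)
open import Data.List.Extrema.Nat using (max; xs≤max)
open import Data.List.Membership.Propositional using (_∈_; _∉_)
import Data.List.Properties as List
import Data.List.Relation.Unary.All as All
open import Data.List.Relation.Unary.Any using (here; there)
open import Data.Nat using (zero; suc; _≟_; _<_)
import Data.Nat.Properties as ℕP
open import Data.Product using (Σ; _,_; proj₁; proj₂; map₂)
open import Function using (_∘_)
open import Level using (0ℓ)
open import Relation.Binary.Bundles using (Setoid)
open import Relation.Binary.PropositionalEquality
open import Relation.Nullary using (yes; no; contradiction)
open import Relation.Unary using (Pred)

FG-setoid : {X : Set} → (X → X → Set) → Setoid 0ℓ 0ℓ
FG-setoid {X} R = record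
  { Carrier       = Word X
  ; _≈_           = FGEq R
  ; isEquivalence = record { refl = fg-refl ; sym = fg-sym ; trans = fg-trans }
  }

module _ {X : Set} {R : X → X → Set} where
  open import Relation.Binary.Reasoning.Setoid (FG-setoid R)

  invLetter-cancel : (l : Letter X) → FGEq R (invLetter l ∷ l ∷ []) []
  invLetter-cancel (true  , x) = fg-cancel false x
  invLetter-cancel (false , x) = fg-cancel true x

  invW-cancelˡ : (w : Word X) → FGEq R (invW w ++ w) []
  invW-cancelˡ []      = fg-refl
  invW-cancelˡ (l ∷ w) = begin
    invW (l ∷ w) ++ l ∷ w                  ≡⟨ cong (_++ l ∷ w) (List.unfold-reverse (invLetter l) (map invLetter w)) ⟩
    (invW w ++ invLetter l ∷ []) ++ l ∷ w  ≡⟨ List.++-assoc (invW w) (invLetter l ∷ []) (l ∷ w) ⟩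
    invW w ++ (invLetter l ∷ l ∷ []) ++ w  ≈⟨ fg-cong (fg-refl {u = invW w}) (fg-cong (invLetter-cancel l) fg-refl) ⟩
    invW w ++ w                            ≈⟨ invW-cancelˡ w ⟩
    []                                     ∎

rename : {X Y : Set} → (X → Y) → Word X → Word Y
rename g = map (map₂ g)

module _ {X Y : Set} (g : X → Y) where

  rename-invW : (w : Word X) → rename g (invW w) ≡ invW (rename g w)
  rename-invW w = begin
    map (map₂ g) (reverse (map invLetter w))   ≡⟨ List.reverse-map (map₂ g) (map invLetter w) ⟩
    reverse (map (map₂ g) (map invLetter w))   ≡⟨ cong reverse (trans (sym (List.map-∘ w)) (List.map-∘ w)) ⟩
    reverse (map invLetter (map (map₂ g) w))   ∎
    where open ≡-Reasoning

  rename-resp : ∀ {u v} → FGEq _≡_ u v → FGEq _≡_ (rename g u) (rename g v)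
  rename-resp fg-refl         = fg-refl
  rename-resp (fg-sym p)      = fg-sym (rename-resp p)
  rename-resp (fg-trans p q)  = fg-trans (rename-resp p) (rename-resp q)
  rename-resp (fg-gen x≡y)    = fg-gen (cong g x≡y)
  rename-resp (fg-cong {u} {u′} {v} {v′} p q) =
    subst₂ (FGEq _≡_) (sym (List.map-++ (map₂ g) u v)) (sym (List.map-++ (map₂ g) u′ v′))
           (fg-cong (rename-resp p) (rename-resp q))
  rename-resp (fg-cancel b x) = fg-cancel b (g x)

evalB-equivariant : (A : NominalSet) (B : Pred (FA A) 0ℓ) (π : Perm)
  (π-closed : ∀ {w} → B w → B (actF A π w)) (u : Word (Σ (FA A) B)) →
  evalB A B (rename (λ β → actF A π (proj₁ β) , π-closed (proj₂ β)) u) ≡ actF A π (evalB A B u)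
evalB-equivariant A B π π-closed [] = refl
evalB-equivariant A B π π-closed ((true , w , _) ∷ u) =
  trans (cong (actF A π w ++_) (evalB-equivariant A B π π-closed u))
        (sym (List.map-++ _ w (evalB A B u)))
evalB-equivariant A B π π-closed ((false , w , _) ∷ u) =
  trans (cong₂ _++_ (sym (rename-invW (NominalSet.act A π) w)) (evalB-equivariant A B π π-closed u))
        (sym (List.map-++ _ (invW w) (evalB A B u)))

module FreeGroupEval {G : Set} {_∙_ : Op₂ G} {ε : G} {_⁻¹ : Op₁ G}
                     (isGroup : IsGroup _≡_ _∙_ ε _⁻¹) where
  open IsGroup isGroup using (assoc; identityˡ; identityʳ; inverseˡ; inverseʳ)

  private
    group : Group 0ℓ 0ℓ
    group = record { isGroup = isGroup }
  open import Algebra.Properties.Group group using (inverseˡ-unique)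

  evalLetter : {X : Set} → (X → G) → Letter X → G
  evalLetter f (true  , x) = f x
  evalLetter f (false , x) = f x ⁻¹

  eval : {X : Set} → (X → G) → Word X → G
  eval f []      = ε
  eval f (l ∷ w) = evalLetter f l ∙ eval f w

  module _ {X : Set} (f : X → G) where

    eval-++ : ∀ u v → eval f (u ++ v) ≡ eval f u ∙ eval f v
    eval-++ []      v = sym (identityˡ (eval f v))
    eval-++ (l ∷ u) v = trans (cong (evalLetter f l ∙_) (eval-++ u v)) (sym (assoc _ _ _))

    evalLetter-cancel : ∀ b x → evalLetter f (b , x) ∙ evalLetter f (not b , x) ≡ ε
    evalLetter-cancel true  x = inverseʳ (f x)
    evalLetter-cancel false x = inverseˡ (f x)

    eval-resp : {R : X → X → Set} → (∀ {x y} → R x y → f x ≡ f y) →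
                ∀ {u v} → FGEq R u v → eval f u ≡ eval f v
    eval-resp f-resp fg-refl        = refl
    eval-resp f-resp (fg-sym p)     = sym (eval-resp f-resp p)
    eval-resp f-resp (fg-trans p q) = trans (eval-resp f-resp p) (eval-resp f-resp q)
    eval-resp f-resp (fg-gen {true}  r) = cong (_∙ ε) (f-resp r)
    eval-resp f-resp (fg-gen {false} r) = cong (λ g → (g ⁻¹) ∙ ε) (f-resp r)
    eval-resp f-resp (fg-cong {u} {u′} {v} {v′} p q) =
      trans (eval-++ u v) (trans (cong₂ _∙_ (eval-resp f-resp p) (eval-resp f-resp q)) (sym (eval-++ u′ v′)))
    eval-resp f-resp (fg-cancel b x) =
      trans (cong (evalLetter f (b , x) ∙_) (identityʳ _)) (evalLetter-cancel b x)

    eval-invW : ∀ w → eval f (invW w) ≡ eval f w ⁻¹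
    eval-invW w = inverseˡ-unique _ _ (trans (sym (eval-++ (invW w) w)) (eval-resp (cong f) (invW-cancelˡ w)))

    eval-rename : {Y : Set} (g : Y → X) → ∀ w → eval f (rename g w) ≡ eval (f ∘ g) w
    eval-rename g []              = refl
    eval-rename g ((true  , y) ∷ w) = cong (f (g y) ∙_) (eval-rename g w)
    eval-rename g ((false , y) ∷ w) = cong ((f (g y) ⁻¹) ∙_) (eval-rename g w)

  eval-cong : {X : Set} {f f′ : X → G} → (∀ x → f x ≡ f′ x) → ∀ w → eval f w ≡ eval f′ w
  eval-cong f≗f′ []              = refl
  eval-cong f≗f′ ((true  , x) ∷ w) = cong₂ _∙_ (f≗f′ x) (eval-cong f≗f′ w)
  eval-cong f≗f′ ((false , x) ∷ w) = cong₂ _∙_ (cong _⁻¹ (f≗f′ x)) (eval-cong f≗f′ w)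

  eval-evalB : (A : NominalSet) (B : Pred (FA A) 0ℓ) (f : NominalSet.Carrier A → G) →
               ∀ u → eval f (evalB A B u) ≡ eval (eval f ∘ proj₁) u
  eval-evalB A B f []                  = refl
  eval-evalB A B f ((true  , w , _) ∷ u) =
    trans (eval-++ f w _) (cong (eval f w ∙_) (eval-evalB A B f u))
  eval-evalB A B f ((false , w , _) ∷ u) =
    trans (eval-++ f (invW w) _) (cong₂ _∙_ (eval-invW f w) (eval-evalB A B f u))

  module _ (comm : Commutative _≡_ _∙_) where
    private
      abelianGroup : AbelianGroup 0ℓ 0ℓ
      abelianGroup = record { isAbelianGroup = record { isGroup = isGroup ; comm = comm } }
    open import Algebra.Properties.AbelianGroup abelianGroup using (⁻¹-∙-comm)
    open import Algebra.Properties.CommutativeSemigroup (AbelianGroup.commutativeSemigroup abelianGroup)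
      using (interchange)

    eval-pointwise-∙ : {X : Set} (f g : X → G) →
                       ∀ w → eval (λ x → f x ∙ g x) w ≡ eval f w ∙ eval g w
    eval-pointwise-∙ f g []              = sym (identityʳ ε)
    eval-pointwise-∙ f g ((b , x) ∷ w) =
      trans (cong₂ _∙_ (letter b) (eval-pointwise-∙ f g w))
            (interchange (evalLetter f (b , x)) (evalLetter g (b , x)) _ _)
      where
      letter : ∀ b → evalLetter (λ x → f x ∙ g x) (b , x) ≡ evalLetter f (b , x) ∙ evalLetter g (b , x)
      letter true  = refl
      letter false = sym (⁻¹-∙-comm (f x) (g x))

module _ {G H : Set}
         {_∙_ : Op₂ G} {ε : G} {_⁻¹ : Op₁ G} (G-isGroup : IsGroup _≡_ _∙_ ε _⁻¹)
         {_·_ : Op₂ H} {e : H} {_⁻¹′ : Op₁ H} (H-isGroup : IsGroup _≡_ _·_ e _⁻¹′)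
         (φ : G → H) (φ-∙ : ∀ g h → φ (g ∙ h) ≡ φ g · φ h) (φ-ε : φ ε ≡ e)
         (φ-⁻¹ : ∀ g → φ (g ⁻¹) ≡ φ g ⁻¹′) where
  private
    module Gₑ = FreeGroupEval G-isGroup
    module Hₑ = FreeGroupEval H-isGroup

  eval-natural : {X : Set} (f : X → G) → ∀ w → φ (Gₑ.eval f w) ≡ Hₑ.eval (φ ∘ f) w
  eval-natural f []              = φ-ε
  eval-natural f ((true  , x) ∷ w) = trans (φ-∙ _ _) (cong (φ (f x) ·_) (eval-natural f w))
  eval-natural f ((false , x) ∷ w) = trans (φ-∙ _ _) (cong₂ _·_ (φ-⁻¹ (f x)) (eval-natural f w))

-- ⟨ x , y , z ⟩ stands for the matrix [[1, x, z], [0, 1, y], [0, 0, 1]].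
record Heisenberg : Set where
  constructor ⟨_,_,_⟩
  field
    hx hy hz : ℤ
open Heisenberg

infixl 7 _⊙_
infix  8 _⁻¹ᴴ

_⊙_ : Heisenberg → Heisenberg → Heisenberg
⟨ x , y , z ⟩ ⊙ ⟨ x′ , y′ , z′ ⟩ = ⟨ x + x′ , y + y′ , z + z′ + x * y′ ⟩

εᴴ : Heisenberg
εᴴ = ⟨ 0ℤ , 0ℤ , 0ℤ ⟩

_⁻¹ᴴ : Heisenberg → Heisenberg
⟨ x , y , z ⟩ ⁻¹ᴴ = ⟨ - x , - y , x * y - z ⟩

⟨⟩-cong : ∀ {x x′ y y′ z z′} → x ≡ x′ → y ≡ y′ → z ≡ z′ → ⟨ x , y , z ⟩ ≡ ⟨ x′ , y′ , z′ ⟩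
⟨⟩-cong refl refl refl = refl

⊙-isGroup : IsGroup _≡_ _⊙_ εᴴ _⁻¹ᴴ
⊙-isGroup = record
  { isMonoid = record
    { isSemigroup = record
      { isMagma  = record { isEquivalence = isEquivalence ; ∙-cong = cong₂ _⊙_ }
      ; assoc    = assoc
      }
    ; identity = identityˡ , identityʳ
    }
  ; inverse  = inverseˡ , inverseʳ
  ; ⁻¹-cong  = cong _⁻¹ᴴ
  }
  where
  assoc : ∀ g h k → (g ⊙ h) ⊙ k ≡ g ⊙ (h ⊙ k)
  assoc ⟨ x , y , z ⟩ ⟨ x′ , y′ , z′ ⟩ ⟨ x″ , y″ , z″ ⟩ =
    ⟨⟩-cong (ℤP.+-assoc x x′ x″) (ℤP.+-assoc y y′ y″) centre
    where
    centre : z + z′ + x * y′ + z″ + (x + x′) * y″ ≡ z + (z′ + z″ + x′ * y″) + x * (y′ + y″)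
    centre = solve (x ∷ x′ ∷ y′ ∷ y″ ∷ z ∷ z′ ∷ z″ ∷ [])

  identityˡ : ∀ g → εᴴ ⊙ g ≡ g
  identityˡ ⟨ x , y , z ⟩ = ⟨⟩-cong (ℤP.+-identityˡ x) (ℤP.+-identityˡ y) centre
    where
    centre : 0ℤ + z + 0ℤ * y ≡ z
    centre = solve (y ∷ z ∷ [])

  identityʳ : ∀ g → g ⊙ εᴴ ≡ g
  identityʳ ⟨ x , y , z ⟩ = ⟨⟩-cong (ℤP.+-identityʳ x) (ℤP.+-identityʳ y) centre
    where
    centre : z + 0ℤ + x * 0ℤ ≡ z
    centre = solve (x ∷ z ∷ [])

  inverseˡ : ∀ g → g ⁻¹ᴴ ⊙ g ≡ εᴴ
  inverseˡ ⟨ x , y , z ⟩ = ⟨⟩-cong (ℤP.+-inverseˡ x) (ℤP.+-inverseˡ y) centre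
    where
    centre : x * y - z + z + - x * y ≡ 0ℤ
    centre = solve (x ∷ y ∷ z ∷ [])

  inverseʳ : ∀ g → g ⊙ g ⁻¹ᴴ ≡ εᴴ
  inverseʳ ⟨ x , y , z ⟩ = ⟨⟩-cong (ℤP.+-inverseʳ x) (ℤP.+-inverseʳ y) centre
    where
    centre : z + (x * y - z) + x * - y ≡ 0ℤ
    centre = solve (x ∷ y ∷ z ∷ [])

module ℤ-Eval = FreeGroupEval ℤP.+-0-isGroup
module H-Eval = FreeGroupEval ⊙-isGroup

central : ℤ → Heisenberg
central k = ⟨ 0ℤ , 0ℤ , k ⟩

eval-central : {X : Set} (f : X → ℤ) → ∀ w → central (ℤ-Eval.eval f w) ≡ H-Eval.eval (central ∘ f) w
eval-central = eval-natural ℤP.+-0-isGroup ⊙-isGroup central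
  (λ k l → ⟨⟩-cong refl refl (sym (ℤP.+-identityʳ (k + l))))
  refl
  (λ k → ⟨⟩-cong refl refl (sym (ℤP.+-identityˡ (- k))))

-- Induced by exchanging the generators ⟨ 1 , 0 , 0 ⟩ and ⟨ 0 , 1 , 0 ⟩.
swapᴴ : Heisenberg → Heisenberg
swapᴴ ⟨ x , y , z ⟩ = ⟨ y , x , x * y - z ⟩

eval-swapᴴ : {X : Set} (f : X → Heisenberg) → ∀ w → swapᴴ (H-Eval.eval f w) ≡ H-Eval.eval (swapᴴ ∘ f) w
eval-swapᴴ = eval-natural ⊙-isGroup ⊙-isGroup swapᴴ swapᴴ-⊙ refl swapᴴ-⁻¹
  where
  swapᴴ-⊙ : ∀ g h → swapᴴ (g ⊙ h) ≡ swapᴴ g ⊙ swapᴴ h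
  swapᴴ-⊙ ⟨ x , y , z ⟩ ⟨ x′ , y′ , z′ ⟩ = ⟨⟩-cong refl refl centre
    where
    centre : (x + x′) * (y + y′) - (z + z′ + x * y′) ≡ x * y - z + (x′ * y′ - z′) + y * x′
    centre = solve (x ∷ x′ ∷ y ∷ y′ ∷ z ∷ z′ ∷ [])

  swapᴴ-⁻¹ : ∀ g → swapᴴ (g ⁻¹ᴴ) ≡ swapᴴ g ⁻¹ᴴ
  swapᴴ-⁻¹ ⟨ x , y , z ⟩ = ⟨⟩-cong refl refl centre
    where
    centre : - x * - y - (x * y - z) ≡ y * x - (x * y - z)
    centre = solve (x ∷ y ∷ z ∷ [])

eval-hx : {X : Set} (f : X → Heisenberg) → ∀ w → hx (H-Eval.eval f w) ≡ ℤ-Eval.eval (hx ∘ f) w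
eval-hx = eval-natural ⊙-isGroup ℤP.+-0-isGroup hx (λ _ _ → refl) refl (λ _ → refl)

eval-hy : {X : Set} (f : X → Heisenberg) → ∀ w → hy (H-Eval.eval f w) ≡ ℤ-Eval.eval (hy ∘ f) w
eval-hy = eval-natural ⊙-isGroup ℤP.+-0-isGroup hy (λ _ _ → refl) refl (λ _ → refl)

atoms : NominalSet
atoms = record
  { Carrier = Atom
  ; act     = to
  ; act-id  = λ _ → refl
  ; act-∘   = λ _ _ _ → refl
  ; act-ext = λ _ _ π≗σ → π≗σ
  ; finSupp = λ a → a ∷ [] , λ _ fixes → fixes a (here refl)
  }

indicator : Atom → Atom → ℤ
indicator c x with x ≟ c
... | yes _ = 1ℤ
... | no  _ = 0ℤ

indicator-self : ∀ c → indicator c c ≡ 1ℤ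
indicator-self c with c ≟ c
... | yes _   = refl
... | no  c≢c = contradiction refl c≢c

indicator-other : ∀ {c x} → x ≢ c → indicator c x ≡ 0ℤ
indicator-other {c} {x} x≢c with x ≟ c
... | yes x≡c = contradiction x≡c x≢c
... | no  _   = refl

indicator-equivariant : ∀ π c x → indicator c (to π x) ≡ indicator (from π c) x
indicator-equivariant π c x with to π x ≟ c | x ≟ from π c
... | yes _    | yes _    = refl
... | no  _    | no  _    = refl
... | yes πx≡c | no  x≢c′ = contradiction (trans (sym (from-to π x)) (cong (from π) πx≡c)) x≢c′
... | no  πx≢c | yes x≡c′ = contradiction (trans (cong (to π) x≡c′) (to-from π c)) πx≢c

indicator-disjoint : ∀ {a b} → a ≢ b → ∀ x → indicator a x * indicator b x ≡ 0ℤ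
indicator-disjoint {a} {b} a≢b x with x ≟ a | x ≟ b
... | yes x≡a | yes x≡b = contradiction (trans (sym x≡a) x≡b) a≢b
... | yes _   | no  _   = refl
... | no  _   | _       = refl

exponentSum : Atom → FA atoms → ℤ
exponentSum c = ℤ-Eval.eval (indicator c)

exponentSum-equivariant : ∀ π c w → exponentSum c (actF atoms π w) ≡ exponentSum (from π c) w
exponentSum-equivariant π c w =
  trans (ℤ-Eval.eval-rename (indicator c) (to π) w) (ℤ-Eval.eval-cong (indicator-equivariant π c) w)

Balanced : Pred (FA atoms) 0ℓ
Balanced w = ∀ c → exponentSum c w ≡ 0ℤ

Balanced-isSubgroup : IsSubgroup atoms Balanced
Balanced-isSubgroup =
    (λ u≈v u-bal c → trans (sym (ℤ-Eval.eval-resp (indicator c) (cong (indicator c)) u≈v)) (u-bal c))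
  , (λ c → refl)
  , (λ u v u-bal v-bal c → trans (ℤ-Eval.eval-++ (indicator c) u v) (cong₂ _+_ (u-bal c) (v-bal c)))
  , (λ u u-bal c → trans (ℤ-Eval.eval-invW (indicator c) u) (cong -_ (u-bal c)))

Balanced-equivariant : FinSuppSubset atoms Balanced
Balanced-equivariant = [] , λ π _ w w-bal c → trans (exponentSum-equivariant π c w) (w-bal (from π c))

module _ (a b : Atom) where

  transpose : Atom → Atom
  transpose x with x ≟ a
  ... | yes _ = b
  ... | no  _ with x ≟ b
  ...   | yes _ = a
  ...   | no  _ = x

  transpose-a : transpose a ≡ b
  transpose-a with a ≟ a
  ... | yes _   = refl
  ... | no  a≢a = contradiction refl a≢a

  transpose-b : transpose b ≡ a
  transpose-b with b ≟ a
  ... | yes b≡a = b≡a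
  ... | no  _ with b ≟ b
  ...   | yes _   = refl
  ...   | no  b≢b = contradiction refl b≢b

  transpose-fixes : ∀ {x} → x ≢ a → x ≢ b → transpose x ≡ x
  transpose-fixes {x} x≢a x≢b with x ≟ a
  ... | yes x≡a = contradiction x≡a x≢a
  ... | no  _ with x ≟ b
  ...   | yes x≡b = contradiction x≡b x≢b
  ...   | no  _   = refl

  transpose-involutive : ∀ x → transpose (transpose x) ≡ x
  transpose-involutive x with x ≟ a
  ... | yes x≡a = trans transpose-b (sym x≡a)
  ... | no  x≢a with x ≟ b
  ...   | yes x≡b = trans transpose-a (sym x≡b)
  ...   | no  x≢b = transpose-fixes x≢a x≢b

  transposition : Perm
  transposition = record
    { to            = transpose
    ; from          = transpose
    ; to-from       = transpose-involutive
    ; from-to       = transpose-involutive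
    ; supp          = a ∷ b ∷ []
    ; fixes-outside = λ x x∉ → transpose-fixes (x∉ ∘ here) (x∉ ∘ there ∘ here)
    }

  transposition-fixes : ∀ {S} → a ∉ S → b ∉ S → Fixes transposition S
  transposition-fixes a∉S b∉S c c∈S =
    transpose-fixes (λ c≡a → a∉S (subst (_∈ _) c≡a c∈S)) (λ c≡b → b∉S (subst (_∈ _) c≡b c∈S))

infix 10 _⁺

_⁺ : ℤ → ℤ
(+ n) ⁺    = + n
-[1+ n ] ⁺ = 0ℤ

i+[-i]⁺≡i⁺ : ∀ i → i + (- i) ⁺ ≡ i ⁺
i+[-i]⁺≡i⁺ (+ zero) = refl
i+[-i]⁺≡i⁺ +[1+ n ] = ℤP.+-identityʳ +[1+ n ]
i+[-i]⁺≡i⁺ -[1+ n ] = ℤP.+-inverseˡ +[1+ n ]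

i+i≢1 : ∀ i → i + i ≢ 1ℤ
i+i≢1 (+ zero) ()
i+i≢1 +[1+ n ] eq = ℕP.m+1+n≢0 n (ℕP.suc-injective (ℤP.+-injective eq))
i+i≢1 -[1+ n ] ()

module _ {a b : Atom} (a≢b : a ≢ b) where

  private
    τ : Perm
    τ = transposition a b

  generator : Atom → Heisenberg
  generator x = ⟨ indicator a x , indicator b x , 0ℤ ⟩

  heis : FA atoms → Heisenberg
  heis = H-Eval.eval generator

  centralPart : FA atoms → ℤ
  centralPart w = hz (heis w)

  centralPart-resp : ∀ {u v} → _≈F_ atoms u v → centralPart u ≡ centralPart v
  centralPart-resp u≈v = cong hz (H-Eval.eval-resp generator (cong generator) u≈v)

  heis-balanced : ∀ w → Balanced w → heis w ≡ central (centralPart w)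
  heis-balanced w w-bal =
    ⟨⟩-cong (trans (eval-hx generator w) (w-bal a)) (trans (eval-hy generator w) (w-bal b)) refl

  generator-transpose : ∀ x → generator (transpose a b x) ≡ swapᴴ (generator x)
  generator-transpose x = ⟨⟩-cong
    (trans (indicator-equivariant τ a x) (cong (λ c → indicator c x) (transpose-a a b)))
    (trans (indicator-equivariant τ b x) (cong (λ c → indicator c x) (transpose-b a b)))
    (sym (cong (_- 0ℤ) (indicator-disjoint a≢b x)))

  heis-transpose : ∀ w → heis (actF atoms τ w) ≡ swapᴴ (heis w)
  heis-transpose w = begin
    heis (actF atoms τ w)                       ≡⟨ H-Eval.eval-rename generator (transpose a b) w ⟩
    H-Eval.eval (generator ∘ transpose a b) w   ≡⟨ H-Eval.eval-cong generator-transpose w ⟩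
    H-Eval.eval (swapᴴ ∘ generator) w           ≡⟨ eval-swapᴴ generator w ⟨
    swapᴴ (heis w)                              ∎
    where open ≡-Reasoning

  centralPart-transpose : ∀ w → Balanced w → centralPart (actF atoms τ w) ≡ - centralPart w
  centralPart-transpose w w-bal =
    trans (cong hz (trans (heis-transpose w) (cong swapᴴ (heis-balanced w w-bal))))
          (ℤP.+-identityˡ (- centralPart w))

  commutator : FA atoms
  commutator = (true , a) ∷ (true , b) ∷ (false , a) ∷ (false , b) ∷ []

  commutator-balanced : Balanced commutator
  commutator-balanced c = cancel (indicator c a) (indicator c b)
    where
    cancel : ∀ p q → p + (q + (- p + (- q + 0ℤ))) ≡ 0ℤ
    cancel p q = solve (p ∷ q ∷ [])

  centralPart-commutator : centralPart commutator ≡ 1ℤ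
  centralPart-commutator =
    cong₂ (λ g h → hz (g ⊙ (h ⊙ (g ⁻¹ᴴ ⊙ (h ⁻¹ᴴ ⊙ εᴴ))))) generator-a generator-b
    where
    generator-a : generator a ≡ ⟨ 1ℤ , 0ℤ , 0ℤ ⟩
    generator-a = ⟨⟩-cong (indicator-self a) (indicator-other a≢b) refl
    generator-b : generator b ≡ ⟨ 0ℤ , 1ℤ , 0ℤ ⟩
    generator-b = ⟨⟩-cong (indicator-other (a≢b ∘ sym)) (indicator-self b) refl

  transpose-commutator : actF atoms τ commutator ≡ invW commutator
  transpose-commutator =
    cong₂ (λ a′ b′ → (true , a′) ∷ (true , b′) ∷ (false , a′) ∷ (false , b′) ∷ [])
          (transpose-a a b) (transpose-b a b)

  module _ (B : Pred (FA atoms) 0ℓ) (B-balanced : ∀ w → B w → Balanced w)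
           (B-invariant : ∀ {w} → B w → B (actF atoms τ w)) where

    τᴮ : Σ (FA atoms) B → Σ (FA atoms) B
    τᴮ (w , w∈B) = actF atoms τ w , B-invariant w∈B

    positiveWeight : Word (Σ (FA atoms) B) → ℤ
    positiveWeight = ℤ-Eval.eval (λ β → centralPart (proj₁ β) ⁺)

    positiveWeight-resp : ∀ {u v} → FGEq (λ β γ → _≈F_ atoms (proj₁ β) (proj₁ γ)) u v →
                          positiveWeight u ≡ positiveWeight v
    positiveWeight-resp = ℤ-Eval.eval-resp _ (cong _⁺ ∘ centralPart-resp)

    centralPart-evalB : ∀ u → centralPart (evalB atoms B u) ≡ ℤ-Eval.eval (centralPart ∘ proj₁) u
    centralPart-evalB u = cong hz (begin
      heis (evalB atoms B u)                          ≡⟨ H-Eval.eval-evalB atoms B generator u ⟩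
      H-Eval.eval (heis ∘ proj₁) u                    ≡⟨ H-Eval.eval-cong heis-B u ⟩
      H-Eval.eval (central ∘ centralPart ∘ proj₁) u   ≡⟨ eval-central (centralPart ∘ proj₁) u ⟨
      central (ℤ-Eval.eval (centralPart ∘ proj₁) u)   ∎)
      where
      open ≡-Reasoning
      heis-B : ∀ β → heis (proj₁ β) ≡ central (centralPart (proj₁ β))
      heis-B (w , w∈B) = heis-balanced w (B-balanced w w∈B)

    positiveWeight-split : ∀ u → centralPart (evalB atoms B u) + positiveWeight (rename τᴮ u) ≡ positiveWeight u
    positiveWeight-split u = begin
      centralPart (evalB atoms B u) + positiveWeight (rename τᴮ u)
        ≡⟨ cong₂ _+_ (centralPart-evalB u) (ℤ-Eval.eval-rename _ τᴮ u) ⟩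
      ℤ-Eval.eval I u + ℤ-Eval.eval (λ β → I (τᴮ β) ⁺) u
        ≡⟨ ℤ-Eval.eval-pointwise-∙ ℤP.+-comm I (λ β → I (τᴮ β) ⁺) u ⟨
      ℤ-Eval.eval (λ β → I β + I (τᴮ β) ⁺) u
        ≡⟨ ℤ-Eval.eval-cong split u ⟩
      positiveWeight u
        ∎
      where
      open ≡-Reasoning
      I : Σ (FA atoms) B → ℤ
      I = centralPart ∘ proj₁
      split : ∀ β → I β + I (τᴮ β) ⁺ ≡ I β ⁺
      split (w , w∈B) = trans (cong (λ k → I (w , w∈B) + k ⁺)
                                    (centralPart-transpose w (B-balanced w w∈B)))
                              (i+[-i]⁺≡i⁺ (I (w , w∈B)))

  transposition-invariant⇒¬FreelyGenerates : (B : Pred (FA atoms) 0ℓ) →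
    (∀ {w} → B w → B (actF atoms τ w)) → ¬ FreelyGenerates atoms B Balanced
  transposition-invariant⇒¬FreelyGenerates B B-invariant (B-balanced , generates , injective)
    with generates commutator commutator-balanced
  ... | u , u↦commutator = i+i≢1 (P u) double
    where
    P : Word (Σ (FA atoms) B) → ℤ
    P = positiveWeight B B-balanced B-invariant
    τu : Word (Σ (FA atoms) B)
    τu = rename (τᴮ B B-balanced B-invariant) u

    weights-differ : 1ℤ + P τu ≡ P u
    weights-differ =
      trans (cong (_+ P τu) (sym (trans (centralPart-resp u↦commutator) centralPart-commutator)))
            (positiveWeight-split B B-balanced B-invariant u)

    evalB-cancels : _≈F_ atoms (evalB atoms B (τu ++ u)) []
    evalB-cancels = begin
      evalB atoms B (τu ++ u)                   ≡⟨ List.concatMap-++ _ τu u ⟩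
      evalB atoms B τu ++ evalB atoms B u       ≡⟨ cong (_++ _) (evalB-equivariant atoms B τ B-invariant u) ⟩
      actF atoms τ (evalB atoms B u) ++ evalB atoms B u
                                                ≈⟨ fg-cong (rename-resp (to τ) u↦commutator) u↦commutator ⟩
      actF atoms τ commutator ++ commutator     ≡⟨ cong (_++ commutator) transpose-commutator ⟩
      invW commutator ++ commutator             ≈⟨ invW-cancelˡ commutator ⟩
      []                                        ∎
      where open import Relation.Binary.Reasoning.Setoid (FG-setoid _≡_)

    weights-cancel : P τu + P u ≡ 0ℤ
    weights-cancel =
      trans (sym (ℤ-Eval.eval-++ _ τu u))
            (positiveWeight-resp B B-balanced B-invariant (injective (τu ++ u) [] evalB-cancels))

    double : P u + P u ≡ 1ℤ
    double = begin
      P u + P u               ≡⟨ cong (_+ P u) weights-differ ⟨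
      (1ℤ + P τu) + P u       ≡⟨ ℤP.+-assoc 1ℤ (P τu) (P u) ⟩
      1ℤ + (P τu + P u)       ≡⟨ cong (λ k → 1ℤ + k) weights-cancel ⟩
      1ℤ                      ∎
      where open ≡-Reasoning

theorem6p3 : ¬ NielsenSchreierNominal
theorem6p3 nielsenSchreier
  with nielsenSchreier atoms Balanced Balanced-isSubgroup Balanced-equivariant
... | B , _ , (S , B-supported) , B-basis =
  transposition-invariant⇒¬FreelyGenerates a≢b B (B-supported (transposition a b) τ-fixes-S _) B-basis
  where
  a b : Atom
  a = suc (max 0 S)
  b = suc a
  a≢b : a ≢ b
  a≢b = ℕP.<⇒≢ (ℕP.n<1+n a)
  above-max-∉ : ∀ {n} → max 0 S < n → n ∉ S
  above-max-∉ max<n n∈S = ℕP.<⇒≱ max<n (All.lookup (xs≤max 0 S) n∈S)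
  τ-fixes-S : Fixes (transposition a b) S
  τ-fixes-S = transposition-fixes a b (above-max-∉ (ℕP.n<1+n _)) (above-max-∉ (ℕP.m<n⇒m<1+n (ℕP.n<1+n _)))
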